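{- Let $L=\{l_n\}_{n\ge1}$ be an increasing sequence (finite or infinite) of positive even integers with counting function $L(y)=\#\{n:l_n\le y\}$. For a nonnegative even integer $x$, let $e(x)$ be the number of pairs $(a,b)$ with $a\le b$, $a,b\in L$, $a+b=x$. Then for every even $x\ge2$, $$e(x)=\sum_{l\in L,\ l\le x/2}L(x-l)-\binom{L(x/2)}{2}-e(x-2)-e(x-4)-\dots-e(0).$$ -}

module Defs where

open import Data.Bool using (Bool; true; false; T; _∧_; if_then_else_)
open import Data.Nat using (ℕ; zero; suc; _+_; _*_; _∸_; _≤_; _<_; _≤ᵇ_; _≡ᵇ_)
open import Data.Nat.Divisibility using (_∣_)
open import Data.List using (List; upTo; map)
open import Data.Nat.ListAction using (sum)
open import Data.Product using (_×_)

-- A set L of naturals, given by its (decidable) characteristic function.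
-- Any increasing sequence (finite or infinite) l₁ < l₂ < … corresponds to
-- exactly one such set, and conversely.
IsEvenPosSet : (ℕ → Bool) → Set
IsEvenPosSet L = ∀ n → T (L n) → (0 < n) × (2 ∣ n)

Σ< : ℕ → (ℕ → ℕ) → ℕ
Σ< n f = sum (map f (upTo n))

[_] : Bool → ℕ
[ b ] = if b then 1 else 0

count : (ℕ → Bool) → ℕ → ℕ
count L y = Σ< (suc y) (λ n → [ L n ])

e : (ℕ → Bool) → ℕ → ℕ
e L x = Σ< (suc x) (λ a → Σ< (suc x) (λ b →
          [ L a ∧ L b ∧ (a ≤ᵇ b) ∧ ((a + b) ≡ᵇ x) ]))

{-# OPTIONS --safe #-}
module Submission where

-- Write x = 2n. The sum Σ_{l ∈ L, l ≤ n} L(2n − l) counts the pairs (a, b) ∈ L² with a ≤ n and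
-- a + b ≤ 2n. Those with a ≤ b are the pairs with sum 2k for some k ≤ n (sums are even), counted by
-- Σ_{k ≤ n} e(2k); those with b < a ≤ n number C(L(n), 2). This double counting is proved by
-- induction on n: passing from n to n + 1 adds the pairs with a + b ∈ {2n + 1, 2n + 2}, and no pair
-- has the odd sum 2n + 1 because L has no odd elements.

open import Defs
open import Data.Bool using (Bool; true; false; T; _∧_; if_then_else_)
open import Data.Integer using (+_; _-_; _⊖_)
open import Data.Integer.Properties using ([+m]-[+n]≡m⊖n; ⊖-≥)
open import Data.List using (upTo; map; _∷_; []; _∷ʳ_; _++_)
open import Data.List.Properties using (upTo-∷ʳ; map-++)
open import Data.Nat using (ℕ; zero; suc; _+_; _*_; _∸_; _/_; _≤_; _<_; _≤ᵇ_; _≡ᵇ_; z≤n; s≤s)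
open import Data.Nat.Combinatorics using (_C_; nCk+nC[k+1]≡[n+1]C[k+1]; nC1≡n)
open import Data.Nat.DivMod using ([m+kn]%n≡m%n; m*n/n≡m)
open import Data.Nat.Divisibility using (_∣_; divides; ∣m+n∣m⇒∣n; n∣m⇒m%n≡0)
open import Data.Nat.ListAction using (sum)
open import Data.Nat.ListAction.Properties using (sum-++)
open import Data.Nat.Properties
open import Algebra.Properties.CommutativeSemigroup +-commutativeSemigroup using (interchange)
open import Data.Nat.Tactic.RingSolver using (solve-∀)
open import Data.Product using (proj₂)
open import Data.Sum using (inj₁; inj₂)
open import Data.Unit using (tt)
open import Function using (_∘_)
open import Relation.Nullary using (¬_; contradiction)
open import Relation.Binary.PropositionalEquality
  using (_≡_; _≢_; refl; sym; trans; cong; cong₂; subst; module ≡-Reasoning)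
open ≡-Reasoning

Σ<-suc : ∀ n (f : ℕ → ℕ) → Σ< (suc n) f ≡ Σ< n f + f n
Σ<-suc n f = begin
  sum (map f (upTo (suc n)))        ≡⟨ cong (sum ∘ map f) (upTo-∷ʳ n) ⟨
  sum (map f (upTo n ∷ʳ n))         ≡⟨ cong sum (map-++ f (upTo n) (n ∷ [])) ⟩
  sum (map f (upTo n) ++ f n ∷ [])  ≡⟨ sum-++ (map f (upTo n)) (f n ∷ []) ⟩
  Σ< n f + (f n + 0)                ≡⟨ cong (_+_ (Σ< n f)) (+-identityʳ (f n)) ⟩
  Σ< n f + f n                      ∎

Σ<-cong : ∀ n {f g : ℕ → ℕ} → (∀ {i} → i < n → f i ≡ g i) → Σ< n f ≡ Σ< n g
Σ<-cong zero    f≗g = refl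
Σ<-cong (suc n) {f} {g} f≗g = begin
  Σ< (suc n) f  ≡⟨ Σ<-suc n f ⟩
  Σ< n f + f n  ≡⟨ cong₂ _+_ (Σ<-cong n (f≗g ∘ m<n⇒m<1+n)) (f≗g (n<1+n n)) ⟩
  Σ< n g + g n  ≡⟨ Σ<-suc n g ⟨
  Σ< (suc n) g  ∎

Σ<-+ : ∀ n (f g : ℕ → ℕ) → Σ< n (λ i → f i + g i) ≡ Σ< n f + Σ< n g
Σ<-+ zero    f g = refl
Σ<-+ (suc n) f g = begin
  Σ< (suc n) (λ i → f i + g i)          ≡⟨ Σ<-suc n _ ⟩
  Σ< n (λ i → f i + g i) + (f n + g n)  ≡⟨ cong (_+ (f n + g n)) (Σ<-+ n f g) ⟩
  (Σ< n f + Σ< n g) + (f n + g n)       ≡⟨ interchange (Σ< n f) (Σ< n g) (f n) (g n) ⟩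
  (Σ< n f + f n) + (Σ< n g + g n)       ≡⟨ cong₂ _+_ (Σ<-suc n f) (Σ<-suc n g) ⟨
  Σ< (suc n) f + Σ< (suc n) g           ∎

Σ<-vanishing-tail : ∀ {k} n (f : ℕ → ℕ) → k ≤ n → (∀ {i} → k ≤ i → i < n → f i ≡ 0) → Σ< n f ≡ Σ< k f
Σ<-vanishing-tail zero    f z≤n tail≡0 = refl
Σ<-vanishing-tail {k} (suc n) f k≤1+n tail≡0 with m≤n⇒m<n∨m≡n k≤1+n
... | inj₂ refl = refl
... | inj₁ (s≤s k≤n) = begin
  Σ< (suc n) f  ≡⟨ Σ<-suc n f ⟩
  Σ< n f + f n  ≡⟨ cong₂ _+_ (Σ<-vanishing-tail n f k≤n (λ k≤i → tail≡0 k≤i ∘ m<n⇒m<1+n)) (tail≡0 k≤n (n<1+n n)) ⟩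
  Σ< k f + 0    ≡⟨ +-identityʳ _ ⟩
  Σ< k f        ∎

Σ<-single : ∀ n (f : ℕ → ℕ) {c} → c < n → (∀ {i} → i ≢ c → f i ≡ 0) → Σ< n f ≡ f c
Σ<-single n f {c} c<n off≡0 = begin
  Σ< n f        ≡⟨ Σ<-vanishing-tail n f c<n (λ c<i _ → off≡0 (>⇒≢ c<i)) ⟩
  Σ< (suc c) f  ≡⟨ Σ<-suc c f ⟩
  Σ< c f + f c  ≡⟨ cong (_+ f c) (Σ<-vanishing-tail c f z≤n (λ _ i<c → off≡0 (<⇒≢ i<c))) ⟩
  f c           ∎

*-[]-true : ∀ {b} m → T b → m * [ b ] ≡ m
*-[]-true {true} m _ = *-identityʳ m

[]-false : ∀ {b} → ¬ T b → [ b ] ≡ 0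
[]-false {true}  ¬b = contradiction tt ¬b
[]-false {false} _  = refl

*-[]-false : ∀ {b} m → ¬ T b → m * [ b ] ≡ 0
*-[]-false m ¬b = trans (cong (m *_) ([]-false ¬b)) (*-zeroʳ m)

[]*-cong : ∀ {b m n} → (T b → m ≡ n) → [ b ] * m ≡ [ b ] * n
[]*-cong {true}  m≡n = cong (_+ 0) (m≡n tt)
[]*-cong {false} _   = refl

[∧∧∧] : ∀ p q r s → [ p ∧ q ∧ r ∧ s ] ≡ [ p ] * [ q ] * [ r ] * [ s ]
[∧∧∧] false q     r     s = refl
[∧∧∧] true  false r     s = refl
[∧∧∧] true  true  false s = refl
[∧∧∧] true  true  true  s = sym (+-identityʳ [ s ])

if-else-0 : ∀ b n → (if b then n else 0) ≡ [ b ] * n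
if-else-0 true  n = sym (+-identityʳ n)
if-else-0 false n = refl

e-as-Σ : ∀ L x → e L x ≡ Σ< (suc x) (λ a → [ L a ] * [ L (x ∸ a) ] * [ a ≤ᵇ x ∸ a ])
e-as-Σ L x = Σ<-cong (suc x) (λ {a} a<1+x → trans (Σ<-single (suc x) _ (s≤s (m∸n≤m x a)) zero-off-b≡x∸a) (at-b≡x∸a a<1+x))
  where
  pair : ℕ → ℕ → ℕ
  pair a b = [ L a ] * [ L b ] * [ a ≤ᵇ b ]
  zero-off-b≡x∸a : ∀ {a b} → b ≢ x ∸ a → [ L a ∧ L b ∧ (a ≤ᵇ b) ∧ (a + b ≡ᵇ x) ] ≡ 0
  zero-off-b≡x∸a {a} {b} b≢x∸a = begin
    [ L a ∧ L b ∧ (a ≤ᵇ b) ∧ (a + b ≡ᵇ x) ]  ≡⟨ [∧∧∧] (L a) (L b) (a ≤ᵇ b) (a + b ≡ᵇ x) ⟩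
    pair a b * [ a + b ≡ᵇ x ]                 ≡⟨ *-[]-false (pair a b) (b≢x∸a ∘ b≡x∸a) ⟩
    0                                         ∎
    where
    b≡x∸a : T (a + b ≡ᵇ x) → b ≡ x ∸ a
    b≡x∸a a+b≡x = trans (sym (m+n∸m≡n a b)) (cong (_∸ a) (≡ᵇ⇒≡ (a + b) x a+b≡x))
  at-b≡x∸a : ∀ {a} → a < suc x → [ L a ∧ L (x ∸ a) ∧ (a ≤ᵇ x ∸ a) ∧ (a + (x ∸ a) ≡ᵇ x) ] ≡ pair a (x ∸ a)
  at-b≡x∸a {a} (s≤s a≤x) = trans ([∧∧∧] (L a) (L (x ∸ a)) (a ≤ᵇ x ∸ a) _)
                           (*-[]-true (pair a (x ∸ a)) (≡⇒≡ᵇ _ _ (m+[n∸m]≡n a≤x)))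

m+m≡m*2 : ∀ m → m + m ≡ m * 2
m+m≡m*2 m = trans (cong (_+_ m) (sym (+-identityʳ m))) (*-comm 2 m)

m*2∸m≡m : ∀ m → m * 2 ∸ m ≡ m
m*2∸m≡m m = trans (cong (_∸ m) (sym (m+m≡m*2 m))) (m+n∸n≡m m m)

m≤n⇒m≤n*2∸m : ∀ {m n} → m ≤ n → m ≤ n * 2 ∸ m
m≤n⇒m≤n*2∸m {m} {n} m≤n = m+n≤o⇒m≤o∸n m (subst (_≤ n * 2) (sym (m+m≡m*2 m)) (*-monoˡ-≤ 2 m≤n))

m<n⇒m*2∸n<n : ∀ {m n} → m < n → m * 2 ∸ n < n
m<n⇒m*2∸n<n {m} {n@(suc _)} m<n = m<n+o⇒m∸n<o (m * 2) n (subst (m * 2 <_) (sym (m+m≡m*2 n)) (*-monoˡ-< 2 m<n))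

e-double : ∀ L n → e L (n * 2) ≡ Σ< (suc n) (λ a → [ L a ] * [ L (n * 2 ∸ a) ])
e-double L n = begin
  e L (n * 2)            ≡⟨ e-as-Σ L (n * 2) ⟩
  Σ< (suc (n * 2)) term  ≡⟨ Σ<-vanishing-tail (suc (n * 2)) term (s≤s (m≤m*n n 2)) beyond-half ⟩
  Σ< (suc n) term        ≡⟨ Σ<-cong (suc n) up-to-half ⟩
  Σ< (suc n) (λ a → [ L a ] * [ L (n * 2 ∸ a) ]) ∎
  where
  term : ℕ → ℕ
  term a = [ L a ] * [ L (n * 2 ∸ a) ] * [ a ≤ᵇ n * 2 ∸ a ]
  beyond-half : ∀ {a} → n < a → a < suc (n * 2) → term a ≡ 0
  beyond-half {a} n<a _ = *-[]-false ([ L a ] * [ L (n * 2 ∸ a) ]) (<⇒≱ (m<n⇒m*2∸n<n n<a) ∘ ≤ᵇ⇒≤ a _)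
  up-to-half : ∀ {a} → a < suc n → term a ≡ [ L a ] * [ L (n * 2 ∸ a) ]
  up-to-half {a} (s≤s a≤n) = *-[]-true ([ L a ] * [ L (n * 2 ∸ a) ]) (≤⇒≤ᵇ (m≤n⇒m≤n*2∸m a≤n))

IsEvenSet : (ℕ → Bool) → Set
IsEvenSet L = ∀ n → T (L n) → 2 ∣ n

¬2∣1+m*2 : ∀ m → ¬ 2 ∣ 1 + m * 2
¬2∣1+m*2 m 2∣1+m*2 = contradiction (trans (sym ([m+kn]%n≡m%n 1 m 2)) (n∣m⇒m%n≡0 _ 2 2∣1+m*2)) λ ()

count-suc : ∀ L y → count L (suc y) ≡ count L y + [ L (suc y) ]
count-suc L y = Σ<-suc (suc y) (λ n → [ L n ])

count-+2 : ∀ {L y} → IsEvenSet L → 2 ∣ y → count L (2 + y) ≡ count L y + [ L (2 + y) ]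
count-+2 {L} ev (divides q refl) = begin
  count L (2 + q * 2)                                   ≡⟨ count-suc L (1 + q * 2) ⟩
  count L (1 + q * 2) + [ L (2 + q * 2) ]               ≡⟨ cong (_+ [ L (2 + q * 2) ]) (count-suc L (q * 2)) ⟩
  count L (q * 2) + [ L (1 + q * 2) ] + [ L (2 + q * 2) ] ≡⟨ cong (λ k → count L (q * 2) + k + [ L (2 + q * 2) ]) odd∉L ⟩
  count L (q * 2) + 0 + [ L (2 + q * 2) ]               ≡⟨ cong (_+ [ L (2 + q * 2) ]) (+-identityʳ _) ⟩
  count L (q * 2) + [ L (2 + q * 2) ]                   ∎
  where
  odd∉L : [ L (1 + q * 2) ] ≡ 0
  odd∉L = []-false (¬2∣1+m*2 q ∘ ev _)

count-shift : ∀ {L} → IsEvenSet L → ∀ {l} m → l ≤ m * 2 →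
  [ L l ] * count L (suc m * 2 ∸ l) ≡ [ L l ] * count L (m * 2 ∸ l) + [ L l ] * [ L (suc m * 2 ∸ l) ]
count-shift {L} ev {l} m l≤m*2 = trans ([]*-cong shift) (*-distribˡ-+ [ L l ] _ _)
  where
  shift : T (L l) → count L (suc m * 2 ∸ l) ≡ count L (m * 2 ∸ l) + [ L (suc m * 2 ∸ l) ]
  shift l∈L = begin
    count L (2 + m * 2 ∸ l)                         ≡⟨ cong (count L) (+-∸-assoc 2 l≤m*2) ⟩
    count L (2 + (m * 2 ∸ l))                       ≡⟨ count-+2 ev 2∣m*2∸l ⟩
    count L (m * 2 ∸ l) + [ L (2 + (m * 2 ∸ l)) ]   ≡⟨ cong (λ k → count L (m * 2 ∸ l) + [ L k ]) (+-∸-assoc 2 l≤m*2) ⟨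
    count L (m * 2 ∸ l) + [ L (2 + m * 2 ∸ l) ]     ∎
    where
    2∣m*2∸l : 2 ∣ m * 2 ∸ l
    2∣m*2∸l = ∣m+n∣m⇒∣n (subst (2 ∣_) (sym (m+[n∸m]≡n l≤m*2)) (divides m refl)) (ev l l∈L)

[n+[b]]C2 : ∀ n b → (n + [ b ]) C 2 ≡ n C 2 + [ b ] * n
[n+[b]]C2 n false = trans (cong (_C 2) (+-identityʳ n)) (sym (+-identityʳ (n C 2)))
[n+[b]]C2 n true  = begin
  (n + 1) C 2    ≡⟨ cong (_C 2) (+-comm n 1) ⟩
  suc n C 2      ≡⟨ nCk+nC[k+1]≡[n+1]C[k+1] n 1 ⟨
  n C 1 + n C 2  ≡⟨ cong (_+ n C 2) (nC1≡n n) ⟩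
  n + n C 2      ≡⟨ +-comm n (n C 2) ⟩
  n C 2 + n      ≡⟨ cong (_+_ (n C 2)) (+-identityʳ n) ⟨
  n C 2 + 1 * n  ∎

double-counting : ∀ {L} → IsEvenSet L → ∀ n →
  Σ< (suc n) (λ l → [ L l ] * count L (n * 2 ∸ l)) ≡ Σ< (suc n) (λ k → e L (k * 2)) + count L n C 2
double-counting {L} ev zero with L 0
... | true  = refl
... | false = refl
double-counting {L} ev (suc n) = begin
  Σ< (2 + n) total
    ≡⟨ Σ<-suc (suc n) total ⟩
  Σ< (suc n) total + [ p ] * count L (suc n * 2 ∸ suc n)
    ≡⟨ cong₂ _+_ (Σ<-cong (suc n) (λ l<1+n → count-shift ev n (≤-trans (≤-pred l<1+n) (m≤m*n n 2))))
                 (cong (λ m → [ p ] * count L m) (m*2∸m≡m (suc n))) ⟩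
  Σ< (suc n) (λ l → old l + new l) + [ p ] * count L (suc n)
    ≡⟨ cong₂ _+_ (Σ<-+ (suc n) old new) (cong ([ p ] *_) (count-suc L n)) ⟩
  (Σ< (suc n) old + t) + [ p ] * (c + [ p ])
    ≡⟨ cong (λ s → (s + t) + [ p ] * (c + [ p ])) (double-counting ev n) ⟩
  (E + c C 2 + t) + [ p ] * (c + [ p ])
    ≡⟨ rearrange E (c C 2) t [ p ] c ⟩
  (E + (t + [ p ] * [ p ])) + (c C 2 + [ p ] * c)
    ≡⟨ cong₂ _+_ (cong (_+_ E) e-step) ([n+[b]]C2 c p) ⟨
  (E + e L (suc n * 2)) + (c + [ p ]) C 2
    ≡⟨ cong₂ _+_ (Σ<-suc (suc n) (λ k → e L (k * 2))) (cong (_C 2) (count-suc L n)) ⟨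
  Σ< (2 + n) (λ k → e L (k * 2)) + count L (suc n) C 2 ∎
  where
  p : Bool
  p = L (suc n)
  c E : ℕ
  c = count L n
  E = Σ< (suc n) (λ k → e L (k * 2))
  total old new : ℕ → ℕ
  total l = [ L l ] * count L (suc n * 2 ∸ l)
  old l = [ L l ] * count L (n * 2 ∸ l)
  new l = [ L l ] * [ L (suc n * 2 ∸ l) ]
  t : ℕ
  t = Σ< (suc n) new
  rearrange : ∀ e k t p c → (e + k + t) + p * (c + p) ≡ (e + (t + p * p)) + (k + p * c)
  rearrange = solve-∀
  e-step : e L (suc n * 2) ≡ t + [ p ] * [ p ]
  e-step = begin
    e L (suc n * 2)                               ≡⟨ e-double L (suc n) ⟩
    Σ< (2 + n) new                                ≡⟨ Σ<-suc (suc n) new ⟩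
    t + [ p ] * [ L (suc n * 2 ∸ suc n) ]         ≡⟨ cong (λ m → t + [ p ] * [ L m ]) (m*2∸m≡m (suc n)) ⟩
    t + [ p ] * [ p ]                             ∎

+[m+n]-+n≡+m : ∀ m n → + (m + n) - + n ≡ + m
+[m+n]-+n≡+m m n = begin
  + (m + n) - + n  ≡⟨ [+m]-[+n]≡m⊖n (m + n) n ⟩
  (m + n) ⊖ n      ≡⟨ ⊖-≥ (m≤n+m n m) ⟩
  + (m + n ∸ n)    ≡⟨ cong +_ (m+n∸n≡m m n) ⟩
  + m              ∎

+[m+n]-+m≡+n : ∀ m n → + (m + n) - + m ≡ + n
+[m+n]-+m≡+n m n = trans (cong (λ k → + k - + m) (+-comm m n)) (+[m+n]-+n≡+m n m)

corollary4 : (L : ℕ → Bool) → IsEvenPosSet L →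
    (x : ℕ) → 2 ∣ x → 2 ≤ x →
    + e L x ≡
      + Σ< (suc (x / 2)) (λ l → if L l then count L (x ∸ l) else 0)
      - + (count L (x / 2) C 2)
      - + Σ< (x / 2) (λ k → e L (2 * k))
corollary4 L evenPos .(q * 2) (divides q refl) _ rewrite m*n/n≡m q 2 ⦃ _ ⦄ = begin
  + E                                  ≡⟨ +[m+n]-+m≡+n Σe E ⟨
  + (Σe + E) - + Σe                    ≡⟨ cong (_- + Σe) (+[m+n]-+n≡+m (Σe + E) K) ⟨
  + (Σe + E + K) - + K - + Σe          ≡⟨ cong₂ (λ s t → + s - + K - + t) pairs≡ (Σ<-cong q (λ {k} _ → cong (e L) (*-comm k 2))) ⟩
  + Σ< (suc q) (λ l → if L l then count L (q * 2 ∸ l) else 0) - + K - + Σ< q (λ k → e L (2 * k)) ∎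
  where
  E K Σe : ℕ
  E = e L (q * 2)
  K = count L q C 2
  Σe = Σ< q (λ k → e L (k * 2))
  pairs≡ : Σe + E + K ≡ Σ< (suc q) (λ l → if L l then count L (q * 2 ∸ l) else 0)
  pairs≡ = begin
    Σe + E + K                                          ≡⟨ cong (_+ K) (Σ<-suc q (λ k → e L (k * 2))) ⟨
    Σ< (suc q) (λ k → e L (k * 2)) + K                  ≡⟨ double-counting (λ n n∈L → proj₂ (evenPos n n∈L)) q ⟨
    Σ< (suc q) (λ l → [ L l ] * count L (q * 2 ∸ l))    ≡⟨ Σ<-cong (suc q) (λ {l} _ → if-else-0 (L l) _) ⟨
    Σ< (suc q) (λ l → if L l then count L (q * 2 ∸ l) else 0) ∎
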